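{- Let $p$ be a prime and let $r$ be a positive integer with $p^r>2$. Then for $|x|<1$, $$\sum_{n=1}^{\infty}Q_{p^r}(n)x^n=\frac{x^{p^r}}{(1-x^2)\left(1-x^{2(p^r-1)} \right) }-\frac{x^{p^r}}{1-x^{2p^r}}.$$
   Context: For positive integers $n,k$, $Q_k(n)$ denotes the number of tuples $(t_1,t_2,\ldots,t_{\lceil n/2\rceil})$ of nonnegative integers with $\sum_{i=1}^{\lceil n/2\rceil}(2i-1)t_i=n$ (i.e. partitions of $n$ into odd parts, where $t_i$ is the multiplicity of the part $2i-1$) such that the multinomial coefficient $\binom{t_1+\cdots+t_{\lceil n/2\rceil}}{t_1,\ldots,t_{\lceil n/2\rceil}}=\frac{(t_1+\cdots+t_{\lceil n/2\rceil})!}{t_1!\cdots t_{\lceil n/2\rceil}!}$ equals $k$. -}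

module Defs where

open import Data.Nat as ℕ using (ℕ; zero; suc; _+_; _*_; _∸_; _/_; _≡ᵇ_; _!)
open import Data.Bool using (if_then_else_)
open import Data.Integer as ℤ using (ℤ; +_)
open import Data.List using (List; []; _∷_; concatMap; map; length; filter; upTo)
open import Data.Vec using (Vec; []; _∷_)
open import Data.Product using (_×_)
open import Relation.Binary.PropositionalEquality using (_≡_)
open import Relation.Nullary.Decidable using (Dec; _×-dec_)

-- Partitions into odd parts as multiplicity tuples, and Q_k(n)

ceilHalf : ℕ → ℕ
ceilHalf n = suc n / 2

tuples : (c B : ℕ) → List (Vec ℕ c)
tuples zero    B = [] ∷ []
tuples (suc c) B = concatMap (λ t → map (t ∷_) (tuples c B)) (upTo (suc B))

-- Σ_{i=1}^{c} (2(i+j)-1) t_i  (weightFrom j; the paper's weight is weightFrom 0)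
weightFrom : {c : ℕ} → ℕ → Vec ℕ c → ℕ
weightFrom j []       = 0
weightFrom j (t ∷ ts) = (2 * j + 1) * t + weightFrom (suc j) ts

weight : {c : ℕ} → Vec ℕ c → ℕ
weight = weightFrom 0

vsum : {c : ℕ} → Vec ℕ c → ℕ
vsum []       = 0
vsum (t ∷ ts) = t + vsum ts

factProd : {c : ℕ} → Vec ℕ c → ℕ
factProd []       = 1
factProd (t ∷ ts) = (t !) * factProd ts

-- the multinomial coefficient (Σ t_i)! / ∏ t_i! equals k
-- (stated multiplicatively; the denominator is nonzero)
MultinomialIs : {c : ℕ} → Vec ℕ c → ℕ → Set
MultinomialIs t k = k * factProd t ≡ (vsum t) !

multinomialIs? : {c : ℕ} → (t : Vec ℕ c) → (k : ℕ) → Dec (MultinomialIs t k)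
multinomialIs? t k = k * factProd t ℕ.≟ (vsum t) !

-- Q_k(n): number of tuples (t_1,…,t_{⌈n/2⌉}) with Σ (2i-1) t_i = n and
-- multinomial coefficient equal to k.  (Every such tuple has all t_i ≤ n.)
Q : ℕ → ℕ → ℕ
Q k n = length (filter (λ t → weight t ℕ.≟ n ×-dec multinomialIs? t k)
                       (tuples (ceilHalf n) n))

PS : Set
PS = ℕ → ℤ

sumTo : ℕ → (ℕ → ℤ) → ℤ
sumTo zero    f = f 0
sumTo (suc n) f = sumTo n f ℤ.+ f (suc n)

_⊛_ : PS → PS → PS
(f ⊛ g) n = sumTo n (λ i → f i ℤ.* g (n ∸ i))
infixl 7 _⊛_

_⊕_ : PS → PS → PS
(f ⊕ g) n = f n ℤ.+ g n
infixl 6 _⊕_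

_⊖_ : PS → PS → PS
(f ⊖ g) n = f n ℤ.- g n
infixl 6 _⊖_

X^ : ℕ → PS
X^ k n = if n ≡ᵇ k then + 1 else + 0

oneMinusX^ : ℕ → PS
oneMinusX^ k = X^ 0 ⊖ X^ k

QSeries : ℕ → PS
QSeries k zero    = + 0
QSeries k (suc n) = + Q k (suc n)

-- Write m = p ^ r.  The multinomial coefficient of a tuple of multiplicities is a binomial
-- coefficient C(t₀ + N, t₀) times the multinomial coefficient of the remaining entries; when
-- it equals m both factors divide m, so both are powers of p.  By Legendre's formula the
-- p-part of C(a + b, a) is at most a + b, whereas C(a + b, a) > a + b for a, b ≥ 2; and two
-- consecutive integers ≥ 2 are never both powers of p.  Hence, as m > 2, the tuples counted
-- by Q_m(n) are exactly those with an entry 1 at some position i, an entry m - 1 at some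
-- position k ≠ i and zeros elsewhere, i.e. the solutions of (2i+1) + (2k+1)(m-1) = n with
-- i ≠ k.  All pairs (i, k) have generating function x^m / ((1 - x²)(1 - x^(2(m-1)))) and the
-- diagonal i = k has x^m / (1 - x^(2m)).  These identities are checked coefficientwise:
-- multiplying by 1 - x^k turns f into n ↦ f n - f (n - k).

module Submission where

open import Defs
open import Data.Bool.Base using (true; false; if_then_else_; _∧_)
open import Data.Integer.Base as ℤ using (ℤ; 0ℤ)
import Data.Integer.Properties as ℤ
import Data.Integer.Tactic.RingSolver as ℤ-Solver
open import Data.List.Base using (List; []; _∷_; _++_; map; concatMap; applyUpTo; filter; length)
open import Data.Nat.Base
open import Data.Nat.Combinatorics using (k![n∸k]!∣n!)
open import Data.Nat.Coprimality using (Coprime; coprime-divisor)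
open import Data.Nat.Divisibility
open import Data.Nat.DivMod
open import Data.Nat.Induction using (<-wellFounded)
open import Data.Nat.Primality using (Prime; euclidsLemma; prime⇒irreducible; prime⇒nonZero; prime⇒nonTrivial)
open import Data.Nat.Properties
open import Algebra.Properties.CommutativeSemigroup +-commutativeSemigroup using (interchange; xy∙z≈xz∙y)
open import Data.Nat.Tactic.RingSolver using (solve-∀)
open import Data.Product.Base using (∃-syntax; _×_; _,_; proj₁; proj₂)
open import Data.Sum.Base using (_⊎_; inj₁; inj₂; [_,_])
open import Data.Vec.Base using (Vec; []; _∷_; head; tail)
open import Function.Base using (_∘_)
open import Induction.WellFounded using (Acc; acc)
open import Relation.Binary.PropositionalEquality
  using (_≡_; _≢_; refl; sym; trans; cong; cong₂; subst; subst₂; _≗_; ≢-sym; _→-setoid_; module ≡-Reasoning)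
open import Relation.Nullary using (¬_; Dec; yes; no; does; contradiction)
open import Relation.Nullary.Decidable using (_×-dec_)

private
  variable
    A : Set
    a b c j k n v : ℕ

-- Finite sums

∑< : ℕ → (ℕ → ℕ) → ℕ
∑< zero    f = 0
∑< (suc n) f = f 0 + ∑< n (λ i → f (suc i))

infix 5 ∑<
syntax ∑< n (λ i → e) = ∑[ i < n ] e

∑<-cong : ∀ n {f g : ℕ → ℕ} → (∀ i → f i ≡ g i) → ∑[ i < n ] f i ≡ ∑[ i < n ] g i
∑<-cong zero    f≗g = refl
∑<-cong (suc n) f≗g = cong₂ _+_ (f≗g 0) (∑<-cong n (λ i → f≗g (suc i)))

∑<-+ : ∀ n (f g : ℕ → ℕ) → ∑[ i < n ] (f i + g i) ≡ (∑[ i < n ] f i) + (∑[ i < n ] g i)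
∑<-+ zero    f g = refl
∑<-+ (suc n) f g = trans (cong (f 0 + g 0 +_) (∑<-+ n _ _)) (interchange (f 0) (g 0) _ _)

∑<-zero : ∀ n {f : ℕ → ℕ} → (∀ i → f i ≡ 0) → ∑[ i < n ] f i ≡ 0
∑<-zero zero    f≗0 = refl
∑<-zero (suc n) f≗0 = cong₂ _+_ (f≗0 0) (∑<-zero n (λ i → f≗0 (suc i)))

∑<-extend : ∀ N N′ (f : ℕ → ℕ) → (∀ i → N ≤ i → f i ≡ 0) → N ≤ N′ →
            ∑[ i < N′ ] f i ≡ ∑[ i < N ] f i
∑<-extend zero    N′       f vanish z≤n        = ∑<-zero N′ (λ i → vanish i z≤n)
∑<-extend (suc N) (suc N′) f vanish (s≤s N≤N′) =
  cong (f 0 +_) (∑<-extend N N′ (λ i → f (suc i)) (λ i N≤i → vanish (suc i) (s≤s N≤i)) N≤N′)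

∑<-bound-irrelevant : ∀ N N′ (f : ℕ → ℕ) →
                      (∀ i → N ≤ i → f i ≡ 0) → (∀ i → N′ ≤ i → f i ≡ 0) →
                      ∑[ i < N ] f i ≡ ∑[ i < N′ ] f i
∑<-bound-irrelevant N N′ f vanish vanish′ with ≤-total N N′
... | inj₁ N≤N′ = sym (∑<-extend N N′ f vanish N≤N′)
... | inj₂ N′≤N = ∑<-extend N′ N f vanish′ N′≤N

∑<-offset : ∀ c j (f : ℕ → ℕ) →
            ∑[ i < suc c ] f (j + i) ≡ f j + (∑[ i < c ] f (suc j + i))
∑<-offset c j f = cong₂ _+_ (cong f (+-identityʳ j)) (∑<-cong c (λ i → cong f (+-suc j i)))

∑∑-blocks : ∀ c j (g : ℕ → ℕ → ℕ) →
  ∑[ i < suc c ] ∑[ k < suc c ] g (j + i) (j + k) ≡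
  g j j + (∑[ k < c ] g j (suc j + k)) +
  ((∑[ i < c ] g (suc j + i) j) + (∑[ i < c ] ∑[ k < c ] g (suc j + i) (suc j + k)))
∑∑-blocks c j g = begin
  ∑[ i < suc c ] ∑[ k < suc c ] g (j + i) (j + k)
    ≡⟨ ∑<-offset c j (λ i → ∑[ k < suc c ] g i (j + k)) ⟩
  (∑[ k < suc c ] g j (j + k)) + (∑[ i < c ] ∑[ k < suc c ] g (suc j + i) (j + k))
    ≡⟨ cong₂ _+_ (∑<-offset c j (g j)) (∑<-cong c (λ i → ∑<-offset c j (g (suc j + i)))) ⟩
  g j j + (∑[ k < c ] g j (suc j + k)) +
  (∑[ i < c ] (g (suc j + i) j + (∑[ k < c ] g (suc j + i) (suc j + k))))
    ≡⟨ cong (g j j + (∑[ k < c ] g j (suc j + k)) +_) (∑<-+ c _ _) ⟩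
  g j j + (∑[ k < c ] g j (suc j + k)) +
  ((∑[ i < c ] g (suc j + i) j) + (∑[ i < c ] ∑[ k < c ] g (suc j + i) (suc j + k))) ∎
  where open ≡-Reasoning

δ : ℕ → ℕ → ℕ
δ m n = if m ≡ᵇ n then 1 else 0

δ-refl : ∀ n → δ n n ≡ 1
δ-refl zero    = refl
δ-refl (suc n) = δ-refl n

δ-≢ : ∀ m n → m ≢ n → δ m n ≡ 0
δ-≢ zero    zero    m≢n = contradiction refl m≢n
δ-≢ zero    (suc n) m≢n = refl
δ-≢ (suc m) zero    m≢n = refl
δ-≢ (suc m) (suc n) m≢n = δ-≢ m n (m≢n ∘ cong suc)

δ-> : ∀ {m n} → n < m → δ m n ≡ 0
δ-> n<m = δ-≢ _ _ (≢-sym (<⇒≢ n<m))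

δ-+ : ∀ q m n → δ (q + m) (q + n) ≡ δ m n
δ-+ zero    m n = refl
δ-+ (suc q) m n = δ-+ q m n

∑<-δ : ∀ N a (f : ℕ → ℕ) → a < N → ∑[ v < N ] δ v a * f v ≡ f a
∑<-δ (suc N) zero    f _         = trans (cong (λ x → f 0 + 0 + x) (∑<-zero N (λ _ → refl)))
                                         (trans (+-identityʳ _) (+-identityʳ _))
∑<-δ (suc N) (suc a) f (s≤s a<N) = ∑<-δ N a (λ v → f (suc v)) a<N

∑<-δ-≥ : ∀ N a (f : ℕ → ℕ) → N ≤ a → ∑[ v < N ] δ v a * f v ≡ 0
∑<-δ-≥ zero    a       f _         = refl
∑<-δ-≥ (suc N) (suc a) f (s≤s N≤a) = ∑<-δ-≥ N a (λ v → f (suc v)) N≤a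

∑ˡ : List A → (A → ℕ) → ℕ
∑ˡ []       φ = 0
∑ˡ (x ∷ xs) φ = φ x + ∑ˡ xs φ

infix 5 ∑ˡ
syntax ∑ˡ xs (λ x → e) = ∑[ x ∈ xs ] e

∑ˡ-cong : ∀ (xs : List A) {φ ψ : A → ℕ} → (∀ x → φ x ≡ ψ x) → ∑ˡ xs φ ≡ ∑ˡ xs ψ
∑ˡ-cong []       φ≗ψ = refl
∑ˡ-cong (x ∷ xs) φ≗ψ = cong₂ _+_ (φ≗ψ x) (∑ˡ-cong xs φ≗ψ)

∑ˡ-zero : ∀ (xs : List A) {φ : A → ℕ} → (∀ x → φ x ≡ 0) → ∑ˡ xs φ ≡ 0
∑ˡ-zero []       φ≗0 = refl
∑ˡ-zero (x ∷ xs) φ≗0 = cong₂ _+_ (φ≗0 x) (∑ˡ-zero xs φ≗0)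

∑ˡ-+ : ∀ (xs : List A) (φ ψ : A → ℕ) → ∑[ x ∈ xs ] (φ x + ψ x) ≡ ∑ˡ xs φ + ∑ˡ xs ψ
∑ˡ-+ []       φ ψ = refl
∑ˡ-+ (x ∷ xs) φ ψ = trans (cong (φ x + ψ x +_) (∑ˡ-+ xs φ ψ)) (interchange (φ x) (ψ x) _ _)

∑ˡ-*ˡ : ∀ k (xs : List A) (φ : A → ℕ) → ∑[ x ∈ xs ] k * φ x ≡ k * ∑ˡ xs φ
∑ˡ-*ˡ k []       φ = sym (*-zeroʳ k)
∑ˡ-*ˡ k (x ∷ xs) φ = trans (cong (k * φ x +_) (∑ˡ-*ˡ k xs φ)) (sym (*-distribˡ-+ k (φ x) _))

∑ˡ-++ : ∀ (xs ys : List A) (φ : A → ℕ) → ∑ˡ (xs ++ ys) φ ≡ ∑ˡ xs φ + ∑ˡ ys φ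
∑ˡ-++ []       ys φ = refl
∑ˡ-++ (x ∷ xs) ys φ = trans (cong (φ x +_) (∑ˡ-++ xs ys φ)) (sym (+-assoc (φ x) _ _))

∑ˡ-concatMap : ∀ {B : Set} (g : A → List B) (xs : List A) (φ : B → ℕ) →
               ∑ˡ (concatMap g xs) φ ≡ ∑[ x ∈ xs ] ∑ˡ (g x) φ
∑ˡ-concatMap g []       φ = refl
∑ˡ-concatMap g (x ∷ xs) φ =
  trans (∑ˡ-++ (g x) (concatMap g xs) φ) (cong (∑ˡ (g x) φ +_) (∑ˡ-concatMap g xs φ))

∑ˡ-map : ∀ {B : Set} (g : A → B) (xs : List A) (φ : B → ℕ) → ∑ˡ (map g xs) φ ≡ ∑[ x ∈ xs ] φ (g x)
∑ˡ-map g []       φ = refl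
∑ˡ-map g (x ∷ xs) φ = cong (φ (g x) +_) (∑ˡ-map g xs φ)

∑ˡ-applyUpTo : ∀ (g : ℕ → A) n (φ : A → ℕ) → ∑ˡ (applyUpTo g n) φ ≡ ∑[ i < n ] φ (g i)
∑ˡ-applyUpTo g zero    φ = refl
∑ˡ-applyUpTo g (suc n) φ = cong (φ (g 0) +_) (∑ˡ-applyUpTo (λ i → g (suc i)) n φ)

if-does : ∀ {P : Set} (P? : Dec P) {x} → (P → x ≡ 1) → (¬ P → x ≡ 0) → (if does P? then 1 else 0) ≡ x
if-does (yes p) x≡1 _ = sym (x≡1 p)
if-does (no ¬p) _ x≡0 = sym (x≡0 ¬p)

length-filter : ∀ {P : A → Set} (P? : ∀ x → Dec (P x)) (xs : List A) →
                length (filter P? xs) ≡ ∑[ x ∈ xs ] (if does (P? x) then 1 else 0)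
length-filter P? []       = refl
length-filter P? (x ∷ xs) with does (P? x)
... | true  = cong suc (length-filter P? xs)
... | false = length-filter P? xs

-- Formal power series

data Offset (k : ℕ) : ℕ → Set where
  below : n < k → Offset k n
  above : ∀ n → Offset k (k + n)

offset : ∀ k n → Offset k n
offset zero    n       = above n
offset (suc k) zero    = below z<s
offset (suc k) (suc n) with offset k n
... | below n<k = below (s<s n<k)
... | above n   = above n

shift : ℕ → PS → PS
shift zero    f n       = f n
shift (suc k) f zero    = 0ℤ
shift (suc k) f (suc n) = shift k f n

shift-< : ∀ k (F : PS) {n} → n < k → shift k F n ≡ 0ℤ
shift-< (suc k) F {zero}  _         = refl
shift-< (suc k) F {suc n} (s<s n<k) = shift-< k F n<k

shift-+ : ∀ k (F : PS) n → shift k F (k + n) ≡ F n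
shift-+ zero    F n = refl
shift-+ (suc k) F n = shift-+ k F n

shift-⊖ : ∀ k (F G : PS) → shift k (F ⊖ G) ≗ shift k F ⊖ shift k G
shift-⊖ zero    F G n       = refl
shift-⊖ (suc k) F G zero    = refl
shift-⊖ (suc k) F G (suc n) = shift-⊖ k F G n

shift-cong : ∀ k {F G : PS} → F ≗ G → shift k F ≗ shift k G
shift-cong zero    F≗G n       = F≗G n
shift-cong (suc k) F≗G zero    = refl
shift-cong (suc k) F≗G (suc n) = shift-cong k F≗G n

shift-shift : ∀ a b (F : PS) → shift a (shift b F) ≗ shift (a + b) F
shift-shift zero    b F n       = refl
shift-shift (suc a) b F zero    = refl
shift-shift (suc a) b F (suc n) = shift-shift a b F n

shift-comm : ∀ a b (F : PS) → shift a (shift b F) ≗ shift b (shift a F)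
shift-comm a b F n = begin
  shift a (shift b F) n ≡⟨ shift-shift a b F n ⟩
  shift (a + b) F n     ≡⟨ cong (λ s → shift s F n) (+-comm a b) ⟩
  shift (b + a) F n     ≡⟨ shift-shift b a F n ⟨
  shift b (shift a F) n ∎
  where open ≡-Reasoning

sumTo-cong : ∀ n {F G : ℕ → ℤ} → (∀ i → i ≤ n → F i ≡ G i) → sumTo n F ≡ sumTo n G
sumTo-cong zero    F≗G = F≗G 0 z≤n
sumTo-cong (suc n) F≗G =
  cong₂ ℤ._+_ (sumTo-cong n (λ i i≤n → F≗G i (m≤n⇒m≤1+n i≤n))) (F≗G (suc n) ≤-refl)

sumTo-sub : ∀ n (F G : ℕ → ℤ) → sumTo n (λ i → F i ℤ.- G i) ≡ sumTo n F ℤ.- sumTo n G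
sumTo-sub zero    F G = refl
sumTo-sub (suc n) F G = trans (cong (ℤ._+ (F (suc n) ℤ.- G (suc n))) (sumTo-sub n F G))
                            (rearrange (sumTo n F) (sumTo n G) (F (suc n)) (G (suc n)))
  where
  rearrange : ∀ a b c d → (a ℤ.- b) ℤ.+ (c ℤ.- d) ≡ (a ℤ.+ c) ℤ.- (b ℤ.+ d)
  rearrange = ℤ-Solver.solve-∀

sumTo-zero : ∀ n {F : ℕ → ℤ} → (∀ i → i ≤ n → F i ≡ 0ℤ) → sumTo n F ≡ 0ℤ
sumTo-zero zero    F≗0 = F≗0 0 z≤n
sumTo-zero (suc n) F≗0 =
  cong₂ ℤ._+_ (sumTo-zero n (λ i i≤n → F≗0 i (m≤n⇒m≤1+n i≤n))) (F≗0 (suc n) ≤-refl)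

sumTo-single : ∀ n {F : ℕ → ℤ} i₀ → i₀ ≤ n → (∀ i → i ≤ n → i ≢ i₀ → F i ≡ 0ℤ) →
               sumTo n F ≡ F i₀
sumTo-single zero    .0 z≤n _ = refl
sumTo-single (suc n) {F} i₀ i₀≤1+n F≗0 with i₀ ≟ suc n
... | yes refl =
  trans (cong (ℤ._+ F (suc n)) (sumTo-zero n (λ i i≤n → F≗0 i (m≤n⇒m≤1+n i≤n) (<⇒≢ (s≤s i≤n)))))
        (ℤ.+-identityˡ (F (suc n)))
... | no i₀≢1+n =
  trans (cong₂ ℤ._+_ (sumTo-single n i₀ (≤-pred (≤∧≢⇒< i₀≤1+n i₀≢1+n)) (λ i i≤n → F≗0 i (m≤n⇒m≤1+n i≤n)))
                     (F≗0 (suc n) ≤-refl (≢-sym i₀≢1+n)))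
        (ℤ.+-identityʳ (F i₀))

X^-δ : ∀ m n → X^ m n ≡ ℤ.+ δ m n
X^-δ zero    zero    = refl
X^-δ zero    (suc n) = refl
X^-δ (suc m) zero    = refl
X^-δ (suc m) (suc n) = X^-δ m n

X^-≢ : ∀ m n → m ≢ n → X^ m n ≡ 0ℤ
X^-≢ m n m≢n = trans (X^-δ m n) (cong ℤ.+_ (δ-≢ m n m≢n))

⊛-X^ : ∀ (F : PS) k → F ⊛ X^ k ≗ shift k F
⊛-X^ F k n with offset k n
... | below n<k = begin
  (F ⊛ X^ k) n ≡⟨ sumTo-zero n (λ i _ → trans (cong (F i ℤ.*_) (X^-≢ k (n ∸ i) (n∸i≢k i)))
                                              (ℤ.*-zeroʳ (F i))) ⟩
  0ℤ           ≡⟨ shift-< k F n<k ⟨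
  shift k F n  ∎
  where
  open ≡-Reasoning
  n∸i≢k : ∀ i → k ≢ n ∸ i
  n∸i≢k i k≡n∸i = <⇒≱ n<k (≤-trans (≤-reflexive k≡n∸i) (m∸n≤m n i))
... | above m = begin
  (F ⊛ X^ k) (k + m)               ≡⟨ sumTo-single (k + m) m (m≤n+m m k) others ⟩
  F m ℤ.* X^ k (k + m ∸ m)         ≡⟨ cong (λ x → F m ℤ.* X^ k x) (m+n∸n≡m k m) ⟩
  F m ℤ.* X^ k k                   ≡⟨ cong (F m ℤ.*_) (trans (X^-δ k k) (cong ℤ.+_ (δ-refl k))) ⟩
  F m ℤ.* ℤ.1ℤ                     ≡⟨ ℤ.*-identityʳ (F m) ⟩
  F m                              ≡⟨ shift-+ k F m ⟨
  shift k F (k + m)                ∎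
  where
  open ≡-Reasoning
  others : ∀ i → i ≤ k + m → i ≢ m → F i ℤ.* X^ k (k + m ∸ i) ≡ 0ℤ
  others i i≤k+m i≢m = trans (cong (F i ℤ.*_) (X^-≢ k (k + m ∸ i) k≢k+m∸i)) (ℤ.*-zeroʳ (F i))
    where
    k≢k+m∸i : k ≢ k + m ∸ i
    k≢k+m∸i k≡k+m∸i = i≢m (+-cancelˡ-≡ k i m (begin
      k + i             ≡⟨ cong (_+ i) k≡k+m∸i ⟩
      (k + m ∸ i) + i   ≡⟨ m∸n+n≡m i≤k+m ⟩
      k + m             ∎))

⊛-distribˡ-⊖ : ∀ (F G H : PS) → F ⊛ (G ⊖ H) ≗ F ⊛ G ⊖ F ⊛ H
⊛-distribˡ-⊖ F G H n =
  trans (sumTo-cong n (λ i _ → *-distribˡ-- (F i) (G (n ∸ i)) (H (n ∸ i)))) (sumTo-sub n _ _)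
  where
  *-distribˡ-- : ∀ a b c → a ℤ.* (b ℤ.- c) ≡ a ℤ.* b ℤ.- a ℤ.* c
  *-distribˡ-- = ℤ-Solver.solve-∀

⊛-oneMinusX^ : ∀ (F : PS) k → F ⊛ oneMinusX^ k ≗ F ⊖ shift k F
⊛-oneMinusX^ F k n = trans (⊛-distribˡ-⊖ F (X^ 0) (X^ k) n) (cong₂ ℤ._-_ (⊛-X^ F 0 n) (⊛-X^ F k n))

⊛-congˡ : ∀ {F G : PS} H → F ≗ G → F ⊛ H ≗ G ⊛ H
⊛-congˡ H F≗G n = sumTo-cong n (λ i _ → cong (ℤ._* H (n ∸ i)) (F≗G i))

⊖-cong : ∀ {F F′ G G′ : PS} → F ≗ F′ → G ≗ G′ → F ⊖ G ≗ F′ ⊖ G′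
⊖-cong F≗F′ G≗G′ n = cong₂ ℤ._-_ (F≗F′ n) (G≗G′ n)

private
  sub-interchange : ∀ a b c d → (a ℤ.- b) ℤ.- (c ℤ.- d) ≡ (a ℤ.- c) ℤ.- (b ℤ.- d)
  sub-interchange = ℤ-Solver.solve-∀

⊖-⊛-oneMinusX^ : ∀ (F G : PS) k → (F ⊖ G) ⊛ oneMinusX^ k ≗ F ⊛ oneMinusX^ k ⊖ G ⊛ oneMinusX^ k
⊖-⊛-oneMinusX^ F G k n = begin
  ((F ⊖ G) ⊛ oneMinusX^ k) n
    ≡⟨ ⊛-oneMinusX^ (F ⊖ G) k n ⟩
  (F n ℤ.- G n) ℤ.- shift k (F ⊖ G) n
    ≡⟨ cong (λ x → (F n ℤ.- G n) ℤ.- x) (shift-⊖ k F G n) ⟩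
  (F n ℤ.- G n) ℤ.- (shift k F n ℤ.- shift k G n)
    ≡⟨ sub-interchange (F n) (G n) _ _ ⟩
  (F n ℤ.- shift k F n) ℤ.- (G n ℤ.- shift k G n)
    ≡⟨ cong₂ ℤ._-_ (⊛-oneMinusX^ F k n) (⊛-oneMinusX^ G k n) ⟨
  (F ⊛ oneMinusX^ k ⊖ G ⊛ oneMinusX^ k) n ∎
  where open ≡-Reasoning

⊛-oneMinusX^-comm : ∀ (F : PS) a b → F ⊛ oneMinusX^ a ⊛ oneMinusX^ b ≗ F ⊛ oneMinusX^ b ⊛ oneMinusX^ a
⊛-oneMinusX^-comm F a b n = begin
  (F ⊛ oneMinusX^ a ⊛ oneMinusX^ b) n
    ≡⟨ expand a b ⟩
  (F n ℤ.- shift a F n) ℤ.- (shift b F n ℤ.- shift b (shift a F) n)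
    ≡⟨ cong (λ x → (F n ℤ.- shift a F n) ℤ.- (shift b F n ℤ.- x)) (shift-comm b a F n) ⟩
  (F n ℤ.- shift a F n) ℤ.- (shift b F n ℤ.- shift a (shift b F) n)
    ≡⟨ sub-interchange (F n) _ _ _ ⟩
  (F n ℤ.- shift b F n) ℤ.- (shift a F n ℤ.- shift a (shift b F) n)
    ≡⟨ expand b a ⟨
  (F ⊛ oneMinusX^ b ⊛ oneMinusX^ a) n ∎
  where
  open ≡-Reasoning
  expand : ∀ a b → (F ⊛ oneMinusX^ a ⊛ oneMinusX^ b) n ≡
                   (F n ℤ.- shift a F n) ℤ.- (shift b F n ℤ.- shift b (shift a F) n)
  expand a b = begin
    (F ⊛ oneMinusX^ a ⊛ oneMinusX^ b) n
      ≡⟨ ⊛-oneMinusX^ (F ⊛ oneMinusX^ a) b n ⟩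
    (F ⊛ oneMinusX^ a) n ℤ.- shift b (F ⊛ oneMinusX^ a) n
      ≡⟨ cong₂ ℤ._-_ (⊛-oneMinusX^ F a n)
                     (trans (shift-cong b (⊛-oneMinusX^ F a) n) (shift-⊖ b F (shift a F) n)) ⟩
    (F n ℤ.- shift a F n) ℤ.- (shift b F n ℤ.- shift b (shift a F) n) ∎

toPS : (ℕ → ℕ) → PS
toPS f n = ℤ.+ f n

⊛-oneMinusX^-recurrence : ∀ k (f g : ℕ → ℕ) → (∀ n → n < k → f n ≡ g n) →
                          (∀ n → f (k + n) ≡ g (k + n) + f n) → toPS f ⊛ oneMinusX^ k ≗ toPS g
⊛-oneMinusX^-recurrence k f g initial step n with offset k n
... | below n<k = begin
  (toPS f ⊛ oneMinusX^ k) n           ≡⟨ ⊛-oneMinusX^ (toPS f) k n ⟩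
  ℤ.+ f n ℤ.- shift k (toPS f) n      ≡⟨ cong (λ x → ℤ.+ f n ℤ.- x) (shift-< k (toPS f) n<k) ⟩
  ℤ.+ f n ℤ.- 0ℤ                      ≡⟨ ℤ.+-identityʳ (ℤ.+ f n) ⟩
  ℤ.+ f n                             ≡⟨ cong ℤ.+_ (initial n n<k) ⟩
  ℤ.+ g n                             ∎
  where open ≡-Reasoning
... | above m = begin
  (toPS f ⊛ oneMinusX^ k) (k + m)             ≡⟨ ⊛-oneMinusX^ (toPS f) k (k + m) ⟩
  ℤ.+ f (k + m) ℤ.- shift k (toPS f) (k + m)  ≡⟨ cong₂ (λ x y → ℤ.+ x ℤ.- y) (step m) (shift-+ k (toPS f) m) ⟩
  ℤ.+ (g (k + m) + f m) ℤ.- ℤ.+ f m           ≡⟨ cong (ℤ._- ℤ.+ f m) (ℤ.pos-+ (g (k + m)) (f m)) ⟩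
  ℤ.+ g (k + m) ℤ.+ ℤ.+ f m ℤ.- ℤ.+ f m       ≡⟨ +-minus (ℤ.+ g (k + m)) (ℤ.+ f m) ⟩
  ℤ.+ g (k + m)                               ∎
  where
  open ≡-Reasoning
  +-minus : ∀ a b → a ℤ.+ b ℤ.- b ≡ a
  +-minus = ℤ-Solver.solve-∀

-- Tuples with at most two nonzero entries

data Zeros : Vec ℕ c → Set where
  []  : Zeros []
  0∷_ : {ts : Vec ℕ c} → Zeros ts → Zeros (0 ∷ ts)

data Single (v : ℕ) : Vec ℕ c → Set where
  v∷_ : {ts : Vec ℕ c} → Zeros ts → Single v (v ∷ ts)
  0∷_ : {ts : Vec ℕ c} → Single v ts → Single v (0 ∷ ts)

data Pair (a b : ℕ) : Vec ℕ c → Set where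
  0∷_ : {ts : Vec ℕ c} → Pair a b ts → Pair a b (0 ∷ ts)
  a∷_ : {ts : Vec ℕ c} → Single b ts → Pair a b (a ∷ ts)
  b∷_ : {ts : Vec ℕ c} → Single a ts → Pair a b (b ∷ ts)

vsum-Zeros : {t : Vec ℕ c} → Zeros t → vsum t ≡ 0
vsum-Zeros []     = refl
vsum-Zeros (0∷ z) = vsum-Zeros z

factProd-Zeros : {t : Vec ℕ c} → Zeros t → factProd t ≡ 1
factProd-Zeros []     = refl
factProd-Zeros (0∷ z) = trans (+-identityʳ _) (factProd-Zeros z)

vsum-Single : {t : Vec ℕ c} → Single v t → vsum t ≡ v
vsum-Single {v = v} (v∷ z) = trans (cong (v +_) (vsum-Zeros z)) (+-identityʳ v)
vsum-Single (0∷ s)         = vsum-Single s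

factProd-Single : {t : Vec ℕ c} → Single v t → factProd t ≡ v !
factProd-Single {v = v} (v∷ z) = trans (cong (v ! *_) (factProd-Zeros z)) (*-identityʳ (v !))
factProd-Single (0∷ s)         = trans (+-identityʳ _) (factProd-Single s)

vsum-Pair : {t : Vec ℕ c} → Pair a b t → vsum t ≡ a + b
vsum-Pair (0∷ s)               = vsum-Pair s
vsum-Pair {a = a} (a∷ s)       = cong (a +_) (vsum-Single s)
vsum-Pair {a = a} {b} (b∷ s)   = trans (cong (b +_) (vsum-Single s)) (+-comm b a)

factProd-Pair : {t : Vec ℕ c} → Pair a b t → factProd t ≡ a ! * b !
factProd-Pair (0∷ s)             = trans (+-identityʳ _) (factProd-Pair s)
factProd-Pair {a = a} (a∷ s)     = cong (a ! *_) (factProd-Single s)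
factProd-Pair {a = a} {b} (b∷ s) = trans (cong (b ! *_) (factProd-Single s)) (*-comm (b !) (a !))

multinomial-Zeros : {t : Vec ℕ c} → Zeros t → MultinomialIs t 1
multinomial-Zeros z rewrite vsum-Zeros z | factProd-Zeros z = refl

multinomial-Single : {t : Vec ℕ c} → Single v t → MultinomialIs t 1
multinomial-Single s rewrite vsum-Single s | factProd-Single s = *-identityˡ _

multinomial-Pair : ∀ {e} {t : Vec ℕ c} → Pair 1 e t → MultinomialIs t (suc e)
multinomial-Pair {e = e} s rewrite vsum-Pair s | factProd-Pair s = cong (suc e *_) (+-identityʳ (e !))

multinomial-unique : ∀ (t : Vec ℕ c) k k′ → MultinomialIs t k → MultinomialIs t k′ → k ≡ k′
multinomial-unique t k k′ eq eq′ = *-cancelʳ-≡ k k′ (factProd t) {{factProd≢0 t}} (trans eq (sym eq′))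
  where
  factProd≢0 : ∀ {c} (t : Vec ℕ c) → NonZero (factProd t)
  factProd≢0 []       = _
  factProd≢0 (t ∷ ts) = m*n≢0 (t !) (factProd ts) {{t !≢0}} {{factProd≢0 ts}}

multinomial-∷ : ∀ C M t₀ (ts : Vec ℕ c) → C * (t₀ ! * vsum ts !) ≡ (t₀ + vsum ts) ! →
                MultinomialIs ts M → MultinomialIs (t₀ ∷ ts) (C * M)
multinomial-∷ C M t₀ ts binomial multinomial = begin
  C * M * (t₀ ! * factProd ts)   ≡⟨ rearrange C M (t₀ !) (factProd ts) ⟩
  C * (t₀ ! * (M * factProd ts)) ≡⟨ cong (λ x → C * (t₀ ! * x)) multinomial ⟩
  C * (t₀ ! * vsum ts !)         ≡⟨ binomial ⟩
  (t₀ + vsum ts) !               ∎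
  where
  open ≡-Reasoning
  rearrange : ∀ w x y z → w * x * (y * z) ≡ w * (y * (x * z))
  rearrange = solve-∀

binomial-∃ : ∀ a b → ∃[ C ] C * (a ! * b !) ≡ (a + b) !
binomial-∃ a b with k![n∸k]!∣n! (m≤m+n a b)
... | divides C eq = C , sym (trans eq (cong (λ x → C * (a ! * x !)) (m+n∸m≡n a b)))

multinomial-∃ : (t : Vec ℕ c) → ∃[ M ] MultinomialIs t M
multinomial-∃ []       = 1 , refl
multinomial-∃ (t₀ ∷ ts) with binomial-∃ t₀ (vsum ts) | multinomial-∃ ts
... | C , binomial | M , multinomial = C * M , multinomial-∷ C M t₀ ts binomial multinomial

[a+b]*[a!*b!]<[a+b]! : ∀ {a b} → 2 ≤ a → 2 ≤ b → (a + b) * (a ! * b !) < (a + b) !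
[a+b]*[a!*b!]<[a+b]! {b = 1} _ (s≤s ())
[a+b]*[a!*b!]<[a+b]! {a} {2} 2≤a _ = begin-strict
  (a + 2) * (a ! * 2)            ≡⟨ cong₂ _*_ (+-comm a 2) (*-comm (a !) 2) ⟩
  (2 + a) * (2 * a !)            <⟨ *-monoʳ-< (2 + a) (*-monoˡ-< (a !) {{a !≢0}} (s≤s 2≤a)) ⟩
  (2 + a) * (suc a * a !)        ≡⟨ cong _! (+-comm 2 a) ⟩
  (a + 2) !                      ∎
  where open ≤-Reasoning
[a+b]*[a!*b!]<[a+b]! {a} {suc (suc (suc b))} 2≤a _ = begin-strict
  (a + suc b′) * (a ! * suc b′ !)      ≡⟨ cong (_* (a ! * suc b′ !)) (+-suc a b′) ⟩
  suc (a + b′) * (a ! * suc b′ !)      ≡⟨ cong (suc (a + b′) *_) (x*[y*z]≡y*[x*z] (a !) (suc b′) (b′ !)) ⟩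
  suc (a + b′) * (suc b′ * (a ! * b′ !)) <⟨ *-monoʳ-< (suc (a + b′)) (begin-strict
      suc b′ * (a ! * b′ !)   ≤⟨ *-monoˡ-≤ (a ! * b′ !) (+-monoˡ-≤ b′ (≤-trans (s≤s z≤n) 2≤a)) ⟩
      (a + b′) * (a ! * b′ !) <⟨ [a+b]*[a!*b!]<[a+b]! 2≤a (s≤s (s≤s z≤n)) ⟩
      (a + b′) !              ∎) ⟩
  suc (a + b′) * (a + b′) !            ≡⟨ cong _! (+-suc a b′) ⟨
  (a + suc b′) !                       ∎
  where
  open ≤-Reasoning
  b′ = suc (suc b)
  x*[y*z]≡y*[x*z] : ∀ x y z → x * (y * z) ≡ y * (x * z)
  x*[y*z]≡y*[x*z] = solve-∀

-- Multinomial coefficients that are prime powers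

module _ {p : ℕ} (p-prime : Prime p) where

  private instance
    p≢0 : NonZero p
    p≢0 = prime⇒nonZero p-prime

  p∤1 : ¬ p ∣ 1
  p∤1 p∣1 = nonTrivial⇒≢1 {{prime⇒nonTrivial p-prime}} (∣1⇒≡1 p∣1)

  p∤* : ∀ {m n} → ¬ p ∣ m → ¬ p ∣ n → ¬ p ∣ m * n
  p∤* p∤m p∤n p∣m*n = [ p∤m , p∤n ] (euclidsLemma _ _ p-prime p∣m*n)

  factorial-split-quotRem : ∀ q r → r < p → ∃[ u ] ¬ p ∣ u × (r + q * p) ! ≡ p ^ q * q ! * u
  factorial-split-quotRem zero    zero    _     = 1 , p∤1 , refl
  factorial-split-quotRem (suc q) zero    _
    with factorial-split-quotRem q (pred p) (subst (pred p <_) (suc-pred p) (n<1+n (pred p)))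
  ... | u , p∤u , eq = u , p∤u , (begin
    (p + q * p) !                              ≡⟨ cong _! p+q*p≡1+[pred[p]+q*p] ⟩
    suc (pred p + q * p) * (pred p + q * p) !  ≡⟨ cong₂ _*_ (sym p+q*p≡1+[pred[p]+q*p]) eq ⟩
    (p + q * p) * (p ^ q * q ! * u)            ≡⟨ rearrange p (p ^ q) q (q !) u ⟩
    p * p ^ q * (suc q * q !) * u              ∎)
    where
    open ≡-Reasoning
    rearrange : ∀ p x q y u → (p + q * p) * (x * y * u) ≡ p * x * (suc q * y) * u
    rearrange = solve-∀
    p+q*p≡1+[pred[p]+q*p] : p + q * p ≡ suc (pred p + q * p)
    p+q*p≡1+[pred[p]+q*p] = cong (_+ q * p) (sym (suc-pred p))
  factorial-split-quotRem q       (suc r) r<p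
    with factorial-split-quotRem q r (<-trans (n<1+n r) r<p)
  ... | u , p∤u , eq = suc (r + q * p) * u , p∤* p∤1+r+q*p p∤u , (begin
    suc (r + q * p) * (r + q * p) !        ≡⟨ cong (suc (r + q * p) *_) eq ⟩
    suc (r + q * p) * (p ^ q * q ! * u)    ≡⟨ rearrange (suc (r + q * p)) (p ^ q) (q !) u ⟩
    p ^ q * q ! * (suc (r + q * p) * u)    ∎)
    where
    open ≡-Reasoning
    rearrange : ∀ w x y u → w * (x * y * u) ≡ x * y * (w * u)
    rearrange = solve-∀
    p∤1+r+q*p : ¬ p ∣ suc r + q * p
    p∤1+r+q*p p∣ = >⇒∤ r<p (∣m+n∣m⇒∣n (subst (p ∣_) (+-comm (suc r) (q * p)) p∣) (n∣m*n q))

  factorial-split : ∀ n → ∃[ u ] ¬ p ∣ u × n ! ≡ p ^ (n / p) * (n / p) ! * u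
  factorial-split n with factorial-split-quotRem (n / p) (n % p) (m%n<n n p)
  ... | u , p∤u , eq = u , p∤u , trans (cong _! (m≡m%n+[m/n]*n n p)) eq

  /-+-carry : ∀ y z {c x} → c ≤ 1 → y + z + c ≡ x → ∃[ c′ ] c′ ≤ 1 × y / p + z / p + c′ ≡ x / p
  /-+-carry y z {c} {x} c≤1 y+z+c≡x =
    x / p ∸ (Y + Z) , m≤n+o⇒m∸n≤o (x / p) (Y + Z) (m<1+n⇒m≤n upper) , m+[n∸m]≡n lower
    where
    Y = y / p
    Z = z / p
    open ≤-Reasoning
    lower : Y + Z ≤ x / p
    lower = begin
      Y + Z               ≡⟨ m*n/n≡m (Y + Z) p ⟨
      (Y + Z) * p / p     ≤⟨ /-monoˡ-≤ p (begin
        (Y + Z) * p       ≡⟨ *-distribʳ-+ p Y Z ⟩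
        Y * p + Z * p     ≤⟨ +-mono-≤ (m/n*n≤m y p) (m/n*n≤m z p) ⟩
        y + z             ≤⟨ m≤m+n (y + z) c ⟩
        y + z + c         ≡⟨ y+z+c≡x ⟩
        x                 ∎) ⟩
      x / p               ∎
    <[1+m/p]*p : ∀ m → m < suc (m / p) * p
    <[1+m/p]*p m = begin-strict
      m                   ≡⟨ m≡m%n+[m/n]*n m p ⟩
      m % p + m / p * p   <⟨ +-monoˡ-< (m / p * p) (m%n<n m p) ⟩
      p + m / p * p       ∎
    upper : x / p < suc (Y + Z + 1)
    upper = m<n*o⇒m/o<n (begin-strict
      x                               ≡⟨ y+z+c≡x ⟨
      y + z + c                       ≤⟨ +-monoʳ-≤ (y + z) c≤1 ⟩
      y + z + 1                       <⟨ ≤-reflexive (sym (+-suc-suc y z)) ⟩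
      suc y + suc z                   ≤⟨ +-mono-≤ (<[1+m/p]*p y) (<[1+m/p]*p z) ⟩
      suc Y * p + suc Z * p           ≡⟨ distrib Y Z p ⟩
      suc (Y + Z + 1) * p             ∎)
      where
      +-suc-suc : ∀ y z → suc y + suc z ≡ suc (y + z + 1)
      +-suc-suc = solve-∀
      distrib : ∀ Y Z p → suc Y * p + suc Z * p ≡ suc (Y + Z + 1) * p
      distrib = solve-∀

  private
    legendre-step : ∀ {x y z c′ D B} → y / p + z / p + c′ ≡ x / p → ¬ p ∣ B →
                    p ^ D * (y ! * z !) ∣ x ! * B →
                    ∃[ B′ ] ¬ p ∣ B′ × p ^ D * ((y / p) ! * (z / p) !) ∣ p ^ c′ * ((x / p) ! * B′)
    legendre-step {x} {y} {z} {c′} {D} {B} carry p∤B p^D*y!*z!∣x!*B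
      with factorial-split x | factorial-split y | factorial-split z
    ... | ux , p∤ux , x!≡ | uy , _ , y!≡ | uz , _ , z!≡ =
      ux * B , p∤* p∤ux p∤B ,
      ∣-trans (m∣m*n (uy * uz))
              (*-cancelˡ-∣ (p ^ (Y + Z)) {{m^n≢0 p (Y + Z)}} (subst₂ _∣_ lhs rhs p^D*y!*z!∣x!*B))
      where
      X = x / p
      Y = y / p
      Z = z / p
      open ≡-Reasoning
      lhs : p ^ D * (y ! * z !) ≡ p ^ (Y + Z) * (p ^ D * (Y ! * Z !) * (uy * uz))
      lhs = begin
        p ^ D * (y ! * z !)
          ≡⟨ cong (p ^ D *_) (cong₂ _*_ y!≡ z!≡) ⟩
        p ^ D * (p ^ Y * Y ! * uy * (p ^ Z * Z ! * uz))
          ≡⟨ rearrange (p ^ D) (p ^ Y) (p ^ Z) (Y !) (Z !) uy uz ⟩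
        p ^ Y * p ^ Z * (p ^ D * (Y ! * Z !) * (uy * uz))
          ≡⟨ cong (_* (p ^ D * (Y ! * Z !) * (uy * uz))) (^-distribˡ-+-* p Y Z) ⟨
        p ^ (Y + Z) * (p ^ D * (Y ! * Z !) * (uy * uz)) ∎
        where
        rearrange : ∀ d y z a b u w → d * (y * a * u * (z * b * w)) ≡ y * z * (d * (a * b) * (u * w))
        rearrange = solve-∀
      rhs : x ! * B ≡ p ^ (Y + Z) * (p ^ c′ * (X ! * (ux * B)))
      rhs = begin
        x ! * B
          ≡⟨ cong (_* B) x!≡ ⟩
        p ^ X * X ! * ux * B
          ≡⟨ cong (λ e → p ^ e * X ! * ux * B) carry ⟨
        p ^ (Y + Z + c′) * X ! * ux * B
          ≡⟨ cong (λ e → e * X ! * ux * B) (^-distribˡ-+-* p (Y + Z) c′) ⟩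
        p ^ (Y + Z) * p ^ c′ * X ! * ux * B
          ≡⟨ rearrange (p ^ (Y + Z)) (p ^ c′) (X !) ux B ⟩
        p ^ (Y + Z) * (p ^ c′ * (X ! * (ux * B))) ∎
        where
        rearrange : ∀ a b c u w → a * b * c * u * w ≡ a * (b * (c * (u * w)))
        rearrange = solve-∀

  -- Induction on x, dividing everything by p: ⌊x/p⌋ = ⌊y/p⌋ + ⌊z/p⌋ + c′ with a carry c′ ≤ 1
  -- (/-+-carry) and x! = p^⌊x/p⌋ · ⌊x/p⌋! · u with p ∤ u (factorial-split).  Only a carry
  -- contributes a factor p, so p^D ≤ p · ⌊x/p⌋ ≤ x.
  legendre-bound : ∀ {x y z c D B} → Acc _<_ x → c ≤ 1 → y + z + c ≡ x → ¬ p ∣ B →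
                   p ^ D * (y ! * z !) ∣ x ! * B → D ≡ 0 ⊎ p ^ D ≤ x
  legendre-bound {D = zero} _ _ _ _ _ = inj₁ refl
  legendre-bound {zero} {y} {z} {D = suc D} {B} _ _ _ p∤B p^D*y!*z!∣0!*B =
    contradiction (∣-trans (∣-trans (m∣m*n (p ^ D)) (m∣m*n (y ! * z !)))
                           (subst (p ^ suc D * (y ! * z !) ∣_) (*-identityˡ B) p^D*y!*z!∣0!*B))
                  p∤B
  legendre-bound {suc x} {y} {z} {c} {suc D} {B} (acc rec) c≤1 y+z+c≡x p∤B p^D*y!*z!∣x!*B
    with /-+-carry y z c≤1 y+z+c≡x
  ... | c′ , c′≤1 , carry = inj₂ (bound c′≤1 carry reduced)
    where
    X = suc x / p
    Y = y / p
    Z = z / p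
    step = legendre-step {suc x} {y} {z} {c′} {suc D} {B} carry p∤B p^D*y!*z!∣x!*B
    B′ = proj₁ step
    p∤B′ = proj₁ (proj₂ step)
    reduced = proj₂ (proj₂ step)
    X<1+x : X < suc x
    X<1+x = m/n<m (suc x) p (nonTrivial⇒n>1 p {{prime⇒nonTrivial p-prime}})
    ih : ∀ {c D} → c ≤ 1 → Y + Z + c ≡ X → p ^ D * (Y ! * Z !) ∣ X ! * B′ → D ≡ 0 ⊎ p ^ D ≤ X
    ih {c} {D} c≤1 carry = legendre-bound {X} {Y} {Z} {c} {D} {B′} (rec X<1+x) c≤1 carry p∤B′
    bound : ∀ {c′} → c′ ≤ 1 → Y + Z + c′ ≡ X →
            p ^ suc D * (Y ! * Z !) ∣ p ^ c′ * (X ! * B′) → p ^ suc D ≤ suc x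
    bound z≤n carry reduced
      with ih {0} {suc D} z≤n carry (subst (p ^ suc D * (Y ! * Z !) ∣_) (*-identityˡ (X ! * B′)) reduced)
    ... | inj₂ p^1+D≤X = ≤-trans p^1+D≤X (m/n≤m (suc x) p)
    bound (s≤s z≤n) carry reduced = begin
      p * p ^ D   ≤⟨ *-monoʳ-≤ p p^D≤X ⟩
      p * X       ≡⟨ *-comm p X ⟩
      X * p       ≤⟨ m/n*n≤m (suc x) p ⟩
      suc x       ∎
      where
      open ≤-Reasoning
      cancelled : p ^ D * (Y ! * Z !) ∣ X ! * B′
      cancelled = *-cancelˡ-∣ p (subst₂ _∣_ (*-assoc p (p ^ D) (Y ! * Z !))
                                            (cong (_* (X ! * B′)) (*-identityʳ p)) reduced)
      p^D≤X : p ^ D ≤ X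
      p^D≤X with ih {1} {D} ≤-refl carry cancelled
      ... | inj₁ refl = subst (1 ≤_) carry (m≤n+m 1 (Y + Z))
      ... | inj₂ p^D≤X = p^D≤X

  binomial-not-prime-power : ∀ {a b} s → 2 ≤ a → 2 ≤ b → p ^ s * (a ! * b !) ≢ (a + b) !
  binomial-not-prime-power {a} {b} s 2≤a 2≤b binomial = <-irrefl refl (begin-strict
    (a + b) !              ≡⟨ binomial ⟨
    p ^ s * (a ! * b !)    ≤⟨ *-monoˡ-≤ (a ! * b !) p^s≤a+b ⟩
    (a + b) * (a ! * b !)  <⟨ [a+b]*[a!*b!]<[a+b]! 2≤a 2≤b ⟩
    (a + b) !              ∎)
    where
    open ≤-Reasoning
    p^s≤a+b : p ^ s ≤ a + b
    p^s≤a+b with legendre-bound {a + b} {a} {b} {0} {s} {1} (<-wellFounded (a + b)) z≤n (+-identityʳ (a + b)) p∤1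
                   (divides 1 (trans (*-identityʳ ((a + b) !)) (trans (sym binomial) (sym (*-identityˡ _)))))
    ... | inj₁ s≡0     = subst (λ s → p ^ s ≤ a + b) (sym s≡0) (≤-trans (s≤s z≤n) (m≤n⇒m≤n+o b 2≤a))
    ... | inj₂ p^s≤a+b = p^s≤a+b

  ∣p^⇒≡p^ : ∀ s {d} → d ∣ p ^ s → ∃[ i ] d ≡ p ^ i
  ∣p^⇒≡p^ zero    d∣1 = 0 , ∣1⇒≡1 d∣1
  ∣p^⇒≡p^ (suc s) {d} d∣p*p^s with p ∣? d
  ... | yes (divides q refl) with ∣p^⇒≡p^ s {q} (*-cancelʳ-∣ p (subst (q * p ∣_) (*-comm p (p ^ s)) d∣p*p^s))
  ...   | i , refl = suc i , *-comm (p ^ i) p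
  ∣p^⇒≡p^ (suc s) {d} d∣p*p^s | no p∤d = ∣p^⇒≡p^ s {d} (coprime-divisor d-coprime-p d∣p*p^s)
    where
    d-coprime-p : Coprime d p
    d-coprime-p (i∣d , i∣p) with prime⇒irreducible p-prime i∣p
    ... | inj₁ i≡1 = i≡1
    ... | inj₂ refl = contradiction i∣d p∤d

  p^i≢1+p^[1+j] : ∀ i j → p ^ i ≢ suc (p ^ suc j)
  p^i≢1+p^[1+j] zero    j eq = ≢-nonZero⁻¹ (p ^ suc j) {{m^n≢0 p (suc j)}} (suc-injective (sym eq))
  p^i≢1+p^[1+j] (suc i) j eq = p∤1 (∣m+n∣m⇒∣n {p} {p ^ suc j} {1} p∣p^[1+j]+1 (m∣m*n (p ^ j)))
    where
    p∣p^[1+j]+1 : p ∣ p ^ suc j + 1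
    p∣p^[1+j]+1 = subst (p ∣_) (trans eq (+-comm 1 (p ^ suc j))) (m∣m*n (p ^ i))

  PrimePowerShape : Vec ℕ c → Set
  PrimePowerShape t = Zeros t ⊎ ∃[ e ] Single (suc e) t ⊎ ∃[ e ] Pair 1 (suc e) t

  private
    shape-∷ : ∀ t₀ {ts : Vec ℕ c} i j → p ^ i * (t₀ ! * vsum ts !) ≡ (t₀ + vsum ts) ! →
              MultinomialIs ts (p ^ j) → PrimePowerShape ts → PrimePowerShape (t₀ ∷ ts)
    shape-∷ zero          _ _ _ _ (inj₁ z)                   = inj₁ (0∷ z)
    shape-∷ zero          _ _ _ _ (inj₂ (inj₁ (e , s)))      = inj₂ (inj₁ (e , 0∷ s))
    shape-∷ zero          _ _ _ _ (inj₂ (inj₂ (e , s)))      = inj₂ (inj₂ (e , 0∷ s))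
    shape-∷ (suc t)       _ _ _ _ (inj₁ z)                   = inj₂ (inj₁ (t , v∷ z))
    shape-∷ 1             _ _ _ _ (inj₂ (inj₁ (e , s)))      = inj₂ (inj₂ (e , a∷ s))
    shape-∷ (suc (suc t)) _ _ _ _ (inj₂ (inj₁ (zero , s)))   = inj₂ (inj₂ (suc t , b∷ s))
    shape-∷ (suc (suc t)) {ts} i _ binomial _ (inj₂ (inj₁ (suc e , s))) =
      contradiction binomial (binomial-not-prime-power {suc (suc t)} {vsum ts} i (s≤s (s≤s z≤n))
                                                       (≤-trans (s≤s (s≤s z≤n)) (≤-reflexive (sym (vsum-Single s)))))
    shape-∷ (suc (suc t)) {ts} i _ binomial _ (inj₂ (inj₂ (e , s))) =
      contradiction binomial (binomial-not-prime-power {suc (suc t)} {vsum ts} i (s≤s (s≤s z≤n))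
                                                       (≤-trans (s≤s (s≤s z≤n)) (≤-reflexive (sym (vsum-Pair s)))))
    shape-∷ 1 {ts} i j binomial multinomial (inj₂ (inj₂ (e , s))) = consecutive j p^j≡vsum
      where
      -- The binomial factor is vsum ts + 1 and the multinomial coefficient of ts is vsum ts ≥ 2.
      p^i≡1+vsum : p ^ i ≡ suc (vsum ts)
      p^i≡1+vsum = *-cancelʳ-≡ _ _ (vsum ts !) {{vsum ts !≢0}} (trans (cong (p ^ i *_) (sym (*-identityˡ _))) binomial)
      p^j≡vsum : p ^ j ≡ vsum ts
      p^j≡vsum = trans (multinomial-unique ts (p ^ j) (suc (suc e)) multinomial (multinomial-Pair s)) (sym (vsum-Pair s))
      consecutive : ∀ j → p ^ j ≡ vsum ts → PrimePowerShape (1 ∷ ts)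
      consecutive zero    1≡vsum   = contradiction (trans 1≡vsum (vsum-Pair s)) λ ()
      consecutive (suc j) p^j≡vsum = contradiction (trans p^i≡1+vsum (cong suc (sym p^j≡vsum))) (p^i≢1+p^[1+j] i j)

  multinomial-prime-power-shape : ∀ s (t : Vec ℕ c) → MultinomialIs t (p ^ s) → PrimePowerShape t
  multinomial-prime-power-shape s []        _ = inj₁ []
  multinomial-prime-power-shape s (t₀ ∷ ts) multinomial
    with binomial-∃ t₀ (vsum ts) | multinomial-∃ ts
  ... | C , binomial | M , multinomial′
    with ∣p^⇒≡p^ s (divides M (trans p^s≡C*M (*-comm C M))) | ∣p^⇒≡p^ s (divides C p^s≡C*M)
    where
    p^s≡C*M : p ^ s ≡ C * M
    p^s≡C*M = multinomial-unique (t₀ ∷ ts) (p ^ s) (C * M) multinomial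
                                 (multinomial-∷ C M t₀ ts binomial multinomial′)
  ... | i , refl | j , refl =
    shape-∷ t₀ i j binomial multinomial′ (multinomial-prime-power-shape j ts multinomial′)

  multinomial≡p^r⇒Pair : ∀ {r} → 2 < p ^ r →
                         ∀ {c} (t : Vec ℕ c) → MultinomialIs t (p ^ r) → Pair 1 (p ^ r ∸ 1) t
  multinomial≡p^r⇒Pair {r = r} 2<p^r t multinomial with multinomial-prime-power-shape r t multinomial
  ... | inj₁ z              = contradiction (multinomial-unique t (p ^ r) 1 multinomial (multinomial-Zeros z)) p^r≢1
    where p^r≢1 = >⇒≢ (<-trans (n<1+n 1) 2<p^r)
  ... | inj₂ (inj₁ (e , s)) = contradiction (multinomial-unique t (p ^ r) 1 multinomial (multinomial-Single s)) p^r≢1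
    where p^r≢1 = >⇒≢ (<-trans (n<1+n 1) 2<p^r)
  ... | inj₂ (inj₂ (e , s)) =
    subst (λ b → Pair 1 b t) (cong (_∸ 1) (sym p^r≡2+e)) s
    where p^r≡2+e = multinomial-unique t (p ^ r) (suc (suc e)) multinomial (multinomial-Pair s)

-- Counting tuples by weight

oddPart : ℕ → ℕ
oddPart j = 2 * j + 1

oddPart≢0 : ∀ j → NonZero (oddPart j)
oddPart≢0 j = >-nonZero (m≤n+m 1 (2 * j))

oddPart-mono-≤ : j ≤ k → oddPart j ≤ oddPart k
oddPart-mono-≤ j≤k = +-monoˡ-≤ 1 (*-monoʳ-≤ 2 j≤k)

n<oddPart[n] : ∀ n → n < oddPart n
n<oddPart[n] n = ≤-trans (s≤s (m≤m+n n (n + 0))) (≤-reflexive (+-comm 1 (2 * n)))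

oddPart[suc] : ∀ k → oddPart (suc k) ≡ 2 + oddPart k
oddPart[suc] k = lemma k
  where
  lemma : ∀ k → 2 * (1 + k) + 1 ≡ 2 + (2 * k + 1)
  lemma = solve-∀

∑-tuples-suc : ∀ c B (φ : Vec ℕ (suc c) → ℕ) →
               ∑[ t ∈ tuples (suc c) B ] φ t ≡ ∑[ v < suc B ] ∑[ ts ∈ tuples c B ] φ (v ∷ ts)
∑-tuples-suc c B φ = begin
  ∑ˡ (concatMap (λ v → map (v ∷_) (tuples c B)) (applyUpTo (λ v → v) (suc B))) φ
    ≡⟨ ∑ˡ-concatMap (λ v → map (v ∷_) (tuples c B)) (applyUpTo (λ v → v) (suc B)) φ ⟩
  ∑[ v ∈ applyUpTo (λ v → v) (suc B) ] ∑ˡ (map (v ∷_) (tuples c B)) φ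
    ≡⟨ ∑ˡ-applyUpTo (λ v → v) (suc B) _ ⟩
  ∑[ v < suc B ] ∑ˡ (map (v ∷_) (tuples c B)) φ
    ≡⟨ ∑<-cong (suc B) (λ v → ∑ˡ-map (v ∷_) (tuples c B) φ) ⟩
  ∑[ v < suc B ] ∑[ ts ∈ tuples c B ] φ (v ∷ ts) ∎
  where open ≡-Reasoning

-- Indicator functions of Zeros, Single and Pair, defined by recursion on the first entry so
-- that sums over tuples can be evaluated one entry at a time.
[Zeros] : Vec ℕ c → ℕ
[Zeros] []       = 1
[Zeros] (t ∷ ts) = δ t 0 * [Zeros] ts

[Single] : ℕ → Vec ℕ c → ℕ
[Single] v []       = 0
[Single] v (t ∷ ts) = δ t 0 * [Single] v ts + δ t v * [Zeros] ts

[Pair] : ℕ → ℕ → Vec ℕ c → ℕ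
[Pair] a b []       = 0
[Pair] a b (t ∷ ts) = δ t 0 * [Pair] a b ts + δ t a * [Single] b ts + δ t b * [Single] a ts

private
  δ*-≡0 : ∀ t x y → (t ≡ x → y ≡ 0) → δ t x * y ≡ 0
  δ*-≡0 t x y y≡0 with t ≟ x
  ... | yes refl = trans (cong (_* y) (δ-refl t)) (trans (+-identityʳ y) (y≡0 refl))
  ... | no t≢x   = cong (_* y) (δ-≢ t x t≢x)

[Zeros]≡1 : {t : Vec ℕ c} → Zeros t → [Zeros] t ≡ 1
[Zeros]≡1 []     = refl
[Zeros]≡1 (0∷ z) rewrite [Zeros]≡1 z = refl

[Zeros]≡0 : (t : Vec ℕ c) → ¬ Zeros t → [Zeros] t ≡ 0
[Zeros]≡0 []       ¬z = contradiction [] ¬z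
[Zeros]≡0 (t ∷ ts) ¬z = δ*-≡0 t 0 _ (λ { refl → [Zeros]≡0 ts (¬z ∘ 0∷_) })

[Single]≡1 : {t : Vec ℕ c} → v ≢ 0 → Single v t → [Single] v t ≡ 1
[Single]≡1 {v = v} v≢0 (v∷ z) rewrite δ-≢ v 0 v≢0 | δ-refl v | [Zeros]≡1 z = refl
[Single]≡1 {v = v} v≢0 (0∷ s) rewrite δ-≢ 0 v (≢-sym v≢0) | [Single]≡1 v≢0 s = refl

[Single]≡0 : (t : Vec ℕ c) → ¬ Single v t → [Single] v t ≡ 0
[Single]≡0 []       ¬s = refl
[Single]≡0 {v = v} (t ∷ ts) ¬s =
  cong₂ _+_ (δ*-≡0 t 0 _ (λ { refl → [Single]≡0 ts (¬s ∘ 0∷_) }))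
            (δ*-≡0 t v _ (λ { refl → [Zeros]≡0 ts (¬s ∘ v∷_) }))

[Pair]≡1 : {t : Vec ℕ c} → a ≢ 0 → b ≢ 0 → a ≢ b → Pair a b t → [Pair] a b t ≡ 1
[Pair]≡1 {a = a} {b} a≢0 b≢0 a≢b (0∷ s)
  rewrite δ-≢ 0 a (≢-sym a≢0) | δ-≢ 0 b (≢-sym b≢0) | [Pair]≡1 a≢0 b≢0 a≢b s = refl
[Pair]≡1 {a = a} {b} a≢0 b≢0 a≢b (a∷ s)
  rewrite δ-≢ a 0 a≢0 | δ-refl a | δ-≢ a b a≢b | [Single]≡1 b≢0 s = refl
[Pair]≡1 {a = a} {b} a≢0 b≢0 a≢b (b∷ s)
  rewrite δ-≢ b 0 b≢0 | δ-≢ b a (≢-sym a≢b) | δ-refl b | [Single]≡1 a≢0 s = refl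

[Pair]≡0 : (t : Vec ℕ c) → ¬ Pair a b t → [Pair] a b t ≡ 0
[Pair]≡0 []       ¬p = refl
[Pair]≡0 {a = a} {b} (t ∷ ts) ¬p =
  cong₂ _+_ (cong₂ _+_ (δ*-≡0 t 0 _ (λ { refl → [Pair]≡0 ts (¬p ∘ 0∷_) }))
                       (δ*-≡0 t a _ (λ { refl → [Single]≡0 ts (¬p ∘ a∷_) })))
            (δ*-≡0 t b _ (λ { refl → [Single]≡0 ts (¬p ∘ b∷_) }))

-- A tuple of weight n has no entry above n, so bounding the entries by any B ≥ n loses nothing.
module _ (n B : ℕ) (n≤B : n ≤ B) where

  count : (Vec ℕ c → ℕ) → ℕ → ℕ → ℕ
  count {c} S j o = ∑[ t ∈ tuples c B ] S t * δ (o + weightFrom j t) n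

  count-cong : (S T : Vec ℕ c → ℕ) → (∀ t → S t ≡ T t) → ∀ j o → count S j o ≡ count T j o
  count-cong {c} S T S≗T j o = ∑ˡ-cong (tuples c B) (λ t → cong (_* δ (o + weightFrom j t) n) (S≗T t))

  count-+ : (S T : Vec ℕ c → ℕ) → ∀ j o → count (λ t → S t + T t) j o ≡ count S j o + count T j o
  count-+ {c} S T j o = trans (∑ˡ-cong (tuples c B) (λ t → *-distribʳ-+ (w t) (S t) (T t)))
                              (∑ˡ-+ (tuples c B) (λ t → S t * w t) (λ t → T t * w t))
    where
    w : Vec ℕ c → ℕ
    w t = δ (o + weightFrom j t) n

  count-< : (S : Vec ℕ c → ℕ) → ∀ j {o} → n < o → count S j o ≡ 0
  count-< {c} S j {o} n<o =
    ∑ˡ-zero (tuples c B) (λ t → trans (cong (S t *_) (δ-> (≤-trans n<o (m≤m+n o _)))) (*-zeroʳ (S t)))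

  count-head : ∀ x (S : Vec ℕ c → ℕ) j o →
               count (λ t → δ (head t) x * S (tail t)) j o ≡ count S (suc j) (o + oddPart j * x)
  count-head {c} x S j o = begin
    count (λ t → δ (head t) x * S (tail t)) j o
      ≡⟨ ∑-tuples-suc c B (λ t → δ (head t) x * S (tail t) * δ (o + weightFrom j t) n) ⟩
    ∑[ v < suc B ] summand v
      ≡⟨ ∑<-cong (suc B) {f = summand} {g = λ v → δ v x * f v} pull-out ⟩
    ∑[ v < suc B ] δ v x * f v
      ≡⟨ sift ⟩
    count S (suc j) (o + oddPart j * x) ∎
    where
    open ≡-Reasoning
    summand f : ℕ → ℕ
    summand v = ∑[ ts ∈ tuples c B ] δ v x * S ts * δ (o + (oddPart j * v + weightFrom (suc j) ts)) n
    f v = count S (suc j) (o + oddPart j * v)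
    pull-out : ∀ v → summand v ≡ δ v x * f v
    pull-out v = trans (∑ˡ-cong (tuples c B) (λ ts → trans (*-assoc (δ v x) (S ts) _)
                                                          (cong (λ w → δ v x * (S ts * δ w n)) (sym (+-assoc o _ _)))))
                       (∑ˡ-*ˡ (δ v x) (tuples c B) (λ ts → S ts * δ (o + oddPart j * v + weightFrom (suc j) ts) n))
    sift : ∑[ v < suc B ] δ v x * f v ≡ f x
    sift with x ≤? B
    ... | yes x≤B = ∑<-δ (suc B) x f (s≤s x≤B)
    ... | no  x≰B = trans (∑<-δ-≥ (suc B) x f (≰⇒> x≰B)) (sym (count-< S (suc j) n<o+oddPart*x))
      where
      n<o+oddPart*x : n < o + oddPart j * x
      n<o+oddPart*x = <-≤-trans (≤-<-trans n≤B (≰⇒> x≰B))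
                                (≤-trans (m≤n*m x (oddPart j) {{oddPart≢0 j}}) (m≤n+m _ o))

  private
    o+oddPart*0≡o : ∀ o j → o + oddPart j * 0 ≡ o
    o+oddPart*0≡o o j = trans (cong (o +_) (*-zeroʳ (oddPart j))) (+-identityʳ o)

  count-[Zeros] : ∀ c j o → count {c} [Zeros] j o ≡ δ o n
  count-[Zeros] zero    j o = trans (+-identityʳ _) (trans (+-identityʳ _) (cong (λ w → δ w n) (+-identityʳ o)))
  count-[Zeros] (suc c) j o = begin
    count {suc c} [Zeros] j o
      ≡⟨ count-cong {suc c} [Zeros] (λ t → δ (head t) 0 * [Zeros] (tail t)) (λ { (_ ∷ _) → refl }) j o ⟩
    count {suc c} (λ t → δ (head t) 0 * [Zeros] (tail t)) j o
      ≡⟨ count-head {c} 0 [Zeros] j o ⟩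
    count {c} [Zeros] (suc j) (o + oddPart j * 0)
      ≡⟨ count-[Zeros] c (suc j) (o + oddPart j * 0) ⟩
    δ (o + oddPart j * 0) n
      ≡⟨ cong (λ w → δ w n) (o+oddPart*0≡o o j) ⟩
    δ o n ∎
    where open ≡-Reasoning

  count-[Single] : ∀ c j o v → count {c} ([Single] v) j o ≡ ∑[ i < c ] δ (o + oddPart (j + i) * v) n
  count-[Single] zero    j o v = refl
  count-[Single] (suc c) j o v = begin
    count {suc c} ([Single] v) j o
      ≡⟨ count-cong {suc c} ([Single] v) (λ t → here t + there t) (λ { (_ ∷ _) → refl }) j o ⟩
    count (λ t → here t + there t) j o
      ≡⟨ count-+ here there j o ⟩
    count here j o + count there j o
      ≡⟨ cong₂ _+_ (count-head {c} 0 ([Single] v) j o) (count-head {c} v [Zeros] j o) ⟩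
    count {c} ([Single] v) (suc j) (o + oddPart j * 0) + count {c} [Zeros] (suc j) (o + oddPart j * v)
      ≡⟨ cong₂ _+_ (count-[Single] c (suc j) (o + oddPart j * 0) v) (count-[Zeros] c (suc j) (o + oddPart j * v)) ⟩
    (∑[ i < c ] δ (o + oddPart j * 0 + oddPart (suc j + i) * v) n) + δ (o + oddPart j * v) n
      ≡⟨ +-comm _ (δ (o + oddPart j * v) n) ⟩
    δ (o + oddPart j * v) n + (∑[ i < c ] δ (o + oddPart j * 0 + oddPart (suc j + i) * v) n)
      ≡⟨ cong (δ (o + oddPart j * v) n +_)
              (∑<-cong c (λ i → cong (λ x → δ (x + oddPart (suc j + i) * v) n) (o+oddPart*0≡o o j))) ⟩
    δ (o + oddPart j * v) n + (∑[ i < c ] δ (o + oddPart (suc j + i) * v) n)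
      ≡⟨ ∑<-offset c j (λ i → δ (o + oddPart i * v) n) ⟨
    ∑[ i < suc c ] δ (o + oddPart (j + i) * v) n ∎
    where
    open ≡-Reasoning
    here there : Vec ℕ (suc c) → ℕ
    here  t = δ (head t) 0 * [Single] v (tail t)
    there t = δ (head t) v * [Zeros] (tail t)

  count-[Pair] : ∀ c j o a b →
    count {c} ([Pair] a b) j o + (∑[ i < c ] δ (o + oddPart (j + i) * a + oddPart (j + i) * b) n) ≡
    ∑[ i < c ] ∑[ k < c ] δ (o + oddPart (j + i) * a + oddPart (j + k) * b) n
  count-[Pair] zero    j o a b = refl
  count-[Pair] (suc c) j o a b = begin
    count {suc c} ([Pair] a b) j o + (∑[ i < suc c ] term (j + i) (j + i))
      ≡⟨ cong₂ _+_ expand (∑<-offset c j (λ i → term i i)) ⟩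
    (pairs + row + column) + (term j j + diagonal)
      ≡⟨ rearrange pairs row column (term j j) diagonal ⟩
    term j j + row + (column + (pairs + diagonal))
      ≡⟨ cong (λ x → term j j + row + (column + x)) (count-[Pair] c (suc j) o a b) ⟩
    term j j + row + (column + (∑[ i < c ] ∑[ k < c ] term (suc j + i) (suc j + k)))
      ≡⟨ ∑∑-blocks c j term ⟨
    ∑[ i < suc c ] ∑[ k < suc c ] term (j + i) (j + k) ∎
    where
    open ≡-Reasoning
    term : ℕ → ℕ → ℕ
    term i k = δ (o + oddPart i * a + oddPart k * b) n
    pairs    = count {c} ([Pair] a b) (suc j) o
    row      = ∑[ k < c ] term j (suc j + k)
    column   = ∑[ i < c ] term (suc j + i) j
    diagonal = ∑[ i < c ] term (suc j + i) (suc j + i)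
    rearrange : ∀ p r c d e → (p + r + c) + (d + e) ≡ d + r + (c + (p + e))
    rearrange = solve-∀
    skip first second : Vec ℕ (suc c) → ℕ
    skip   t = δ (head t) 0 * [Pair] a b (tail t)
    first  t = δ (head t) a * [Single] b (tail t)
    second t = δ (head t) b * [Single] a (tail t)
    expand : count {suc c} ([Pair] a b) j o ≡ pairs + row + column
    expand = begin
      count {suc c} ([Pair] a b) j o
        ≡⟨ count-cong {suc c} ([Pair] a b) (λ t → skip t + first t + second t) (λ { (_ ∷ _) → refl }) j o ⟩
      count (λ t → skip t + first t + second t) j o
        ≡⟨ count-+ (λ t → skip t + first t) second j o ⟩
      count (λ t → skip t + first t) j o + count second j o
        ≡⟨ cong (_+ count second j o) (count-+ skip first j o) ⟩
      count skip j o + count first j o + count second j o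
        ≡⟨ cong₂ _+_ (cong₂ _+_ (count-head {c} 0 ([Pair] a b) j o) (count-head {c} a ([Single] b) j o))
                     (count-head {c} b ([Single] a) j o) ⟩
      count {c} ([Pair] a b) (suc j) (o + oddPart j * 0) + count {c} ([Single] b) (suc j) (o + oddPart j * a) +
      count {c} ([Single] a) (suc j) (o + oddPart j * b)
        ≡⟨ cong₂ _+_ (cong₂ _+_ (cong (count {c} ([Pair] a b) (suc j)) (o+oddPart*0≡o o j))
                                (count-[Single] c (suc j) (o + oddPart j * a) b))
                     (count-[Single] c (suc j) (o + oddPart j * b) a) ⟩
      pairs + row + (∑[ i < c ] δ (o + oddPart j * b + oddPart (suc j + i) * a) n)
        ≡⟨ cong (pairs + row +_) (∑<-cong c (λ i → cong (λ x → δ x n) (xy∙z≈xz∙y o _ _))) ⟩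
      pairs + row + column ∎

-- Representations n = o + (2k+1)s

oddMultipleCount : ℕ → ℕ → ℕ → ℕ
oddMultipleCount s o n = ∑[ k < n ] δ (o + oddPart k * s) n

pairCount : ℕ → ℕ → ℕ
pairCount d n = ∑[ i < n ] oddMultipleCount d (oddPart i) n

module _ (s : ℕ) .{{_ : NonZero s}} where

  δ-oddMultiple : ∀ k o {n} → n < oddPart k → δ (o + oddPart k * s) n ≡ 0
  δ-oddMultiple k o n<oddPart[k] = δ-> (≤-trans n<oddPart[k] (≤-trans (m≤m*n (oddPart k) s) (m≤n+m _ o)))

  oddMultipleCount-bound : ∀ N o n → n < oddPart N → ∑[ k < N ] δ (o + oddPart k * s) n ≡ oddMultipleCount s o n
  oddMultipleCount-bound N o n n<oddPart[N] = ∑<-bound-irrelevant N n (λ k → δ (o + oddPart k * s) n)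
    (λ k N≤k → δ-oddMultiple k o (<-≤-trans n<oddPart[N] (oddPart-mono-≤ N≤k)))
    (λ k n≤k → δ-oddMultiple k o (<-≤-trans (n<oddPart[n] n) (oddPart-mono-≤ n≤k)))

  oddMultipleCount-< : ∀ {o n} → n < o → oddMultipleCount s o n ≡ 0
  oddMultipleCount-< {o} {n} n<o = ∑<-zero n (λ k → δ-> (≤-trans n<o (m≤m+n o _)))

  oddMultipleCount-shift : ∀ q o n → oddMultipleCount s (q + o) (q + n) ≡ oddMultipleCount s o n
  oddMultipleCount-shift q o n = begin
    ∑[ k < q + n ] δ (q + o + oddPart k * s) (q + n)
      ≡⟨ ∑<-cong (q + n) (λ k → trans (cong (λ x → δ x (q + n)) (+-assoc q o _)) (δ-+ q _ n)) ⟩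
    ∑[ k < q + n ] δ (o + oddPart k * s) n
      ≡⟨ oddMultipleCount-bound (q + n) o n (<-≤-trans (n<oddPart[n] n) (oddPart-mono-≤ (m≤n+m n q))) ⟩
    oddMultipleCount s o n ∎
    where open ≡-Reasoning

  oddMultipleCount-peel : ∀ o n → oddMultipleCount s o n ≡ δ (o + s) n + oddMultipleCount s (o + 2 * s) n
  oddMultipleCount-peel o n = begin
    oddMultipleCount s o n
      ≡⟨ oddMultipleCount-bound (suc n) o n (<-≤-trans (n<oddPart[n] n) (oddPart-mono-≤ (n≤1+n n))) ⟨
    δ (o + 1 * s) n + (∑[ k < n ] δ (o + oddPart (suc k) * s) n)
      ≡⟨ cong₂ (λ x y → δ x n + y) (cong (o +_) (*-identityˡ s))
                                    (∑<-cong n (λ k → cong (λ x → δ x n) (shifted k))) ⟩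
    δ (o + s) n + oddMultipleCount s (o + 2 * s) n ∎
    where
    open ≡-Reasoning
    shifted : ∀ k → o + oddPart (suc k) * s ≡ o + 2 * s + oddPart k * s
    shifted k = trans (cong (λ x → o + x * s) (oddPart[suc] k)) (lemma o s (oddPart k))
      where
      lemma : ∀ o s x → o + (2 + x) * s ≡ o + 2 * s + x * s
      lemma = solve-∀

  oddMultipleCount-series : ∀ o → toPS (oddMultipleCount s o) ⊛ oneMinusX^ (2 * s) ≗ X^ (o + s)
  oddMultipleCount-series o n = trans (⊛-oneMinusX^-recurrence (2 * s) _ _ initial step n) (sym (X^-δ (o + s) n))
    where
    initial : ∀ n → n < 2 * s → oddMultipleCount s o n ≡ δ (o + s) n
    initial n n<2s = begin
      oddMultipleCount s o n
        ≡⟨ oddMultipleCount-peel o n ⟩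
      δ (o + s) n + oddMultipleCount s (o + 2 * s) n
        ≡⟨ cong (δ (o + s) n +_) (oddMultipleCount-< (<-≤-trans n<2s (m≤n+m _ o))) ⟩
      δ (o + s) n + 0
        ≡⟨ +-identityʳ _ ⟩
      δ (o + s) n ∎
      where open ≡-Reasoning
    step : ∀ n → oddMultipleCount s o (2 * s + n) ≡ δ (o + s) (2 * s + n) + oddMultipleCount s o n
    step n = begin
      oddMultipleCount s o (2 * s + n)
        ≡⟨ oddMultipleCount-peel o (2 * s + n) ⟩
      δ (o + s) (2 * s + n) + oddMultipleCount s (o + 2 * s) (2 * s + n)
        ≡⟨ cong (λ x → δ (o + s) (2 * s + n) + oddMultipleCount s x (2 * s + n)) (+-comm o (2 * s)) ⟩
      δ (o + s) (2 * s + n) + oddMultipleCount s (2 * s + o) (2 * s + n)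
        ≡⟨ cong (δ (o + s) (2 * s + n) +_) (oddMultipleCount-shift (2 * s) o n) ⟩
      δ (o + s) (2 * s + n) + oddMultipleCount s o n ∎
      where open ≡-Reasoning

module _ (d : ℕ) .{{_ : NonZero d}} where

  pairCount-bound : ∀ N n → n < oddPart N → ∑[ i < N ] oddMultipleCount d (oddPart i) n ≡ pairCount d n
  pairCount-bound N n n<oddPart[N] = ∑<-bound-irrelevant N n (λ i → oddMultipleCount d (oddPart i) n)
    (λ i N≤i → oddMultipleCount-< d (<-≤-trans n<oddPart[N] (oddPart-mono-≤ N≤i)))
    (λ i n≤i → oddMultipleCount-< d (<-≤-trans (n<oddPart[n] n) (oddPart-mono-≤ n≤i)))

  pairCount-series : toPS (pairCount d) ⊛ oneMinusX^ 2 ≗ toPS (oddMultipleCount d 1)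
  pairCount-series = ⊛-oneMinusX^-recurrence 2 _ _ initial step
    where
    initial : ∀ n → n < 2 → pairCount d n ≡ oddMultipleCount d 1 n
    initial 0 _               = refl
    initial 1 _               = +-identityʳ _
    initial (suc (suc n)) (s≤s (s≤s ()))
    step : ∀ n → pairCount d (2 + n) ≡ oddMultipleCount d 1 (2 + n) + pairCount d n
    step n = cong (oddMultipleCount d 1 (2 + n) +_) (begin
      ∑[ i < suc n ] oddMultipleCount d (oddPart (suc i)) (2 + n)
        ≡⟨ ∑<-cong (suc n) (λ i → cong (λ o → oddMultipleCount d o (2 + n)) (oddPart[suc] i)) ⟩
      ∑[ i < suc n ] oddMultipleCount d (2 + oddPart i) (2 + n)
        ≡⟨ ∑<-cong (suc n) (λ i → oddMultipleCount-shift d 2 (oddPart i) n) ⟩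
      ∑[ i < suc n ] oddMultipleCount d (oddPart i) n
        ≡⟨ pairCount-bound (suc n) n (<-≤-trans (n<oddPart[n] n) (oddPart-mono-≤ (n≤1+n n))) ⟩
      pairCount d n ∎)
      where open ≡-Reasoning

n<oddPart[ceilHalf[n]] : ∀ n → n < oddPart (ceilHalf n)
n<oddPart[ceilHalf[n]] n = ≤-trans (s≤s (≤-pred (begin
  suc n                         ≡⟨ m≡m%n+[m/n]*n (suc n) 2 ⟩
  suc n % 2 + ceilHalf n * 2    ≤⟨ +-monoˡ-≤ _ (m<1+n⇒m≤n (m%n<n (suc n) 2)) ⟩
  1 + ceilHalf n * 2            ≡⟨ cong suc (*-comm (ceilHalf n) 2) ⟩
  suc (2 * ceilHalf n)          ∎))) (≤-reflexive (+-comm 1 (2 * ceilHalf n)))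
  where open ≤-Reasoning

-- The generating function of Q

module _ (d : ℕ) .{{_ : NonZero d}} (1≢d : 1 ≢ d)
         (multinomial⇒Pair : ∀ {c} (t : Vec ℕ c) → MultinomialIs t (suc d) → Pair 1 d t) where

  private
    multinomial-indicator : (t : Vec ℕ c) → (if does (multinomialIs? t (suc d)) then 1 else 0) ≡ [Pair] 1 d t
    multinomial-indicator t = if-does (multinomialIs? t (suc d))
      (λ multinomial → [Pair]≡1 (λ ()) (≢-nonZero⁻¹ d) 1≢d (multinomial⇒Pair t multinomial))
      (λ ¬multinomial → [Pair]≡0 t (¬multinomial ∘ multinomial-Pair))

    if-∧ : ∀ b₁ b₂ → (if b₁ ∧ b₂ then 1 else 0) ≡ (if b₂ then 1 else 0) * (if b₁ then 1 else 0)
    if-∧ true  b₂ = sym (*-identityʳ (if b₂ then 1 else 0))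
    if-∧ false b₂ = sym (*-zeroʳ (if b₂ then 1 else 0))

    indicator : ∀ n (t : Vec ℕ c) →
                (if does (weight t ≟ n ×-dec multinomialIs? t (suc d)) then 1 else 0) ≡ [Pair] 1 d t * δ (weight t) n
    indicator n t = trans (if-∧ (weight t ≡ᵇ n) (does (multinomialIs? t (suc d))))
                          (cong (_* δ (weight t) n) (multinomial-indicator t))

  Q+diagonal≡pairCount : ∀ n → Q (suc d) n + oddMultipleCount (suc d) 0 n ≡ pairCount d n
  Q+diagonal≡pairCount n = begin
    Q (suc d) n + oddMultipleCount (suc d) 0 n
      ≡⟨ cong (_+ oddMultipleCount (suc d) 0 n) Q≡pairs ⟩
    pairs + oddMultipleCount (suc d) 0 n
      ≡⟨ cong (pairs +_) diagonal ⟨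
    pairs + (∑[ i < ⌈n/2⌉ ] δ (oddPart i * 1 + oddPart i * d) n)
      ≡⟨ count-[Pair] n n ≤-refl ⌈n/2⌉ 0 0 1 d ⟩
    ∑[ i < ⌈n/2⌉ ] ∑[ k < ⌈n/2⌉ ] δ (oddPart i * 1 + oddPart k * d) n
      ≡⟨ ∑<-cong ⌈n/2⌉ (λ i → oddMultipleCount-bound d ⌈n/2⌉ (oddPart i * 1) n n<oddPart[⌈n/2⌉]) ⟩
    ∑[ i < ⌈n/2⌉ ] oddMultipleCount d (oddPart i * 1) n
      ≡⟨ ∑<-cong ⌈n/2⌉ (λ i → cong (λ o → oddMultipleCount d o n) (*-identityʳ (oddPart i))) ⟩
    ∑[ i < ⌈n/2⌉ ] oddMultipleCount d (oddPart i) n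
      ≡⟨ pairCount-bound d ⌈n/2⌉ n n<oddPart[⌈n/2⌉] ⟩
    pairCount d n ∎
    where
    open ≡-Reasoning
    ⌈n/2⌉ = ceilHalf n
    n<oddPart[⌈n/2⌉] = n<oddPart[ceilHalf[n]] n
    pairs = ∑[ t ∈ tuples ⌈n/2⌉ n ] [Pair] 1 d t * δ (weight t) n
    Q≡pairs : Q (suc d) n ≡ pairs
    Q≡pairs = trans (length-filter (λ t → weight t ≟ n ×-dec multinomialIs? t (suc d)) (tuples ⌈n/2⌉ n))
                    (∑ˡ-cong (tuples ⌈n/2⌉ n) (indicator n))
    diagonal : ∑[ i < ⌈n/2⌉ ] δ (oddPart i * 1 + oddPart i * d) n ≡ oddMultipleCount (suc d) 0 n
    diagonal = trans (∑<-cong ⌈n/2⌉ (λ i → cong (λ x → δ x n) (sym (*-distribˡ-+ (oddPart i) 1 d))))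
                     (oddMultipleCount-bound (suc d) ⌈n/2⌉ 0 n n<oddPart[⌈n/2⌉])

  private
    QSeries≗ : QSeries (suc d) ≗ toPS (pairCount d) ⊖ toPS (oddMultipleCount (suc d) 0)
    QSeries≗ zero    = refl
    QSeries≗ (suc n) = begin
      ℤ.+ Q (suc d) (suc n)
        ≡⟨ +-minus (ℤ.+ Q (suc d) (suc n)) (ℤ.+ D) ⟨
      ℤ.+ Q (suc d) (suc n) ℤ.+ ℤ.+ D ℤ.- ℤ.+ D
        ≡⟨ cong (ℤ._- ℤ.+ D) (ℤ.pos-+ (Q (suc d) (suc n)) D) ⟨
      ℤ.+ (Q (suc d) (suc n) + D) ℤ.- ℤ.+ D
        ≡⟨ cong (λ x → ℤ.+ x ℤ.- ℤ.+ D) (Q+diagonal≡pairCount (suc n)) ⟩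
      ℤ.+ pairCount d (suc n) ℤ.- ℤ.+ D ∎
      where
      open ≡-Reasoning
      D = oddMultipleCount (suc d) 0 (suc n)
      +-minus : ∀ a b → a ℤ.+ b ℤ.- b ≡ a
      +-minus = ℤ-Solver.solve-∀

  series-identity : let m = suc d in
    QSeries m ⊛ oneMinusX^ 2 ⊛ oneMinusX^ (2 * d) ⊛ oneMinusX^ (2 * m) ≗
    X^ m ⊛ oneMinusX^ (2 * m) ⊖ X^ m ⊛ oneMinusX^ 2 ⊛ oneMinusX^ (2 * d)
  series-identity = begin
    QSeries m ⊛ O 2 ⊛ O (2 * d) ⊛ O (2 * m)
      ≈⟨ ⊛-congˡ (O (2 * m)) (⊛-congˡ (O (2 * d)) (⊛-congˡ (O 2) QSeries≗)) ⟩
    (pairs ⊖ diagonal) ⊛ O 2 ⊛ O (2 * d) ⊛ O (2 * m)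
      ≈⟨ ⊛-congˡ (O (2 * m)) (⊛-congˡ (O (2 * d)) (⊖-⊛-oneMinusX^ pairs diagonal 2)) ⟩
    (pairs ⊛ O 2 ⊖ diagonal ⊛ O 2) ⊛ O (2 * d) ⊛ O (2 * m)
      ≈⟨ ⊛-congˡ (O (2 * m)) (⊖-⊛-oneMinusX^ (pairs ⊛ O 2) (diagonal ⊛ O 2) (2 * d)) ⟩
    (pairs ⊛ O 2 ⊛ O (2 * d) ⊖ diagonal ⊛ O 2 ⊛ O (2 * d)) ⊛ O (2 * m)
      ≈⟨ ⊖-⊛-oneMinusX^ (pairs ⊛ O 2 ⊛ O (2 * d)) (diagonal ⊛ O 2 ⊛ O (2 * d)) (2 * m) ⟩
    pairs ⊛ O 2 ⊛ O (2 * d) ⊛ O (2 * m) ⊖ diagonal ⊛ O 2 ⊛ O (2 * d) ⊛ O (2 * m)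
      ≈⟨ ⊖-cong (⊛-congˡ (O (2 * m)) pairs-part) diagonal-part ⟩
    X^ m ⊛ O (2 * m) ⊖ X^ m ⊛ O 2 ⊛ O (2 * d) ∎
    where
    open import Relation.Binary.Reasoning.Setoid (ℕ →-setoid ℤ)
    m = suc d
    O = oneMinusX^
    pairs diagonal : PS
    pairs    = toPS (pairCount d)
    diagonal = toPS (oddMultipleCount m 0)
    pairs-part : pairs ⊛ O 2 ⊛ O (2 * d) ≗ X^ m
    pairs-part = begin
      pairs ⊛ O 2 ⊛ O (2 * d)                    ≈⟨ ⊛-congˡ (O (2 * d)) (pairCount-series d) ⟩
      toPS (oddMultipleCount d 1) ⊛ O (2 * d)    ≈⟨ oddMultipleCount-series d 1 ⟩
      X^ m                                       ∎
    diagonal-part : diagonal ⊛ O 2 ⊛ O (2 * d) ⊛ O (2 * m) ≗ X^ m ⊛ O 2 ⊛ O (2 * d)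
    diagonal-part = begin
      diagonal ⊛ O 2 ⊛ O (2 * d) ⊛ O (2 * m)   ≈⟨ ⊛-oneMinusX^-comm (diagonal ⊛ O 2) (2 * d) (2 * m) ⟩
      diagonal ⊛ O 2 ⊛ O (2 * m) ⊛ O (2 * d)   ≈⟨ ⊛-congˡ (O (2 * d)) (⊛-oneMinusX^-comm diagonal 2 (2 * m)) ⟩
      diagonal ⊛ O (2 * m) ⊛ O 2 ⊛ O (2 * d)   ≈⟨ ⊛-congˡ (O (2 * d)) (⊛-congˡ (O 2) (oddMultipleCount-series m 0)) ⟩
      X^ m ⊛ O 2 ⊛ O (2 * d)                   ∎

theorem2 : (p r : ℕ) → Prime p → 0 < r → 2 < p ^ r →
    (n : ℕ) →
    (QSeries (p ^ r) ⊛ oneMinusX^ 2 ⊛ oneMinusX^ (2 * (p ^ r ∸ 1)) ⊛ oneMinusX^ (2 * p ^ r)) n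
      ≡ (X^ (p ^ r) ⊛ oneMinusX^ (2 * p ^ r)
          ⊖ X^ (p ^ r) ⊛ oneMinusX^ 2 ⊛ oneMinusX^ (2 * (p ^ r ∸ 1))) n
-- The hypothesis 0 < r is implied by 2 < p ^ r.
theorem2 p r p-prime _ 2<p^r = prime-power-series (p ^ r) 2<p^r (multinomial≡p^r⇒Pair p-prime {r} 2<p^r)
  where
  prime-power-series : ∀ m → 2 < m → (∀ {c} (t : Vec ℕ c) → MultinomialIs t m → Pair 1 (m ∸ 1) t) →
    QSeries m ⊛ oneMinusX^ 2 ⊛ oneMinusX^ (2 * (m ∸ 1)) ⊛ oneMinusX^ (2 * m) ≗
    X^ m ⊛ oneMinusX^ (2 * m) ⊖ X^ m ⊛ oneMinusX^ 2 ⊛ oneMinusX^ (2 * (m ∸ 1))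
  prime-power-series (suc (suc zero)) (s≤s (s≤s ()))
  prime-power-series (suc (suc (suc d))) _ multinomial⇒Pair = series-identity (suc (suc d)) (λ ()) multinomial⇒Pair
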